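{- Let $a,b,c,d,e,f,g$ be positive integers with $d^2=a^2+b^2$, $e^2=a^2+c^2$, $f^2=b^2+c^2$ and $g^2=a^2+b^2+c^2$. Set $d_g=g+f$, $d_b=d+b$ and $d_c=e+c$. Then $$\left(\frac{a^2}{d_g}\right)^2+2a^2+d_g^2=\left(\frac{a^2}{d_b}\right)^2+d_b^2+\left(\frac{a^2}{d_c}\right)^2+d_c^2.$$ -}

module Defs where

open import Data.Nat using (ℕ; _+_; _*_; _<_; NonZero; >-nonZero)
open import Data.Nat.Properties using (m≤n⇒m≤o+n)
open import Data.Integer using (+_)
open import Data.Rational using (ℚ; _/_)
import Data.Rational as Q

sqQuot : (x y : ℕ) → .{{NonZero y}} → ℚ
sqQuot x y = ((+ x) / y) Q.* ((+ x) / y)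

ℕtoℚ : ℕ → ℚ
ℕtoℚ n = (+ n) / 1

sumPos : (u v : ℕ) → 0 < v → 0 < u + v
sumPos u v p = m≤n⇒m≤o+n u p

term : (a u v : ℕ) → 0 < v → ℚ
term a u v p = sqQuot (a * a) (u + v) {{>-nonZero (sumPos u v p)}} Q.+ ℕtoℚ ((u + v) * (u + v))

lhs4 : (a b c d e f g : ℕ) → 0 < b → 0 < c → 0 < f → ℚ
lhs4 a b c d e f g pb pc pf = sqQuot (a * a) (g + f) {{>-nonZero (sumPos g f pf)}}
  Q.+ ℕtoℚ (2 * (a * a)) Q.+ ℕtoℚ ((g + f) * (g + f))

rhs4 : (a b c d e f g : ℕ) → 0 < b → 0 < c → 0 < f → ℚ
rhs4 a b c d e f g pb pc pf = term a d b pb Q.+ term a e c pc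

{-# OPTIONS --safe #-}
-- If u² = a² + v² then a² = (u − v)(u + v), so a² / (u + v) = u − v and
-- (a² / (u + v))² + (u + v)² = (u − v)² + (u + v)² = 2u² + 2v².
-- Since g² = a² + f², d² = a² + b² and e² = a² + c², both sides of the identity
-- become integers, each equal to 4(a² + b² + c²). Positivity is needed only to
-- keep the denominators nonzero.
module Submission where

open import Defs
open import Algebra.Bundles using (CommutativeMonoid)
open import Data.List using (_∷_; [])
open import Data.Nat using (ℕ; suc; _+_; _*_; _<_; _≤_; NonZero; >-nonZero)
import Data.Nat.Properties as ℕ
open import Data.Nat.Tactic.RingSolver using (solve-∀; solve)
open import Data.Integer using (+_)
import Data.Integer as ℤ
import Data.Integer.Properties as ℤ
open import Data.Product using (_,_)
open import Data.Rational as ℚ using (_/_; toℚᵘ)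
import Data.Rational.Properties as ℚ
open import Data.Rational.Unnormalised as ℚᵘ using (ℚᵘ; mkℚᵘ; _≃_; *≡*)
import Data.Rational.Unnormalised.Properties as ℚᵘ
open import Relation.Binary.PropositionalEquality
  using (_≡_; refl; sym; trans; cong; cong₂; subst; module ≡-Reasoning)

open import Algebra.Properties.CommutativeSemigroup
  (CommutativeMonoid.commutativeSemigroup ℚ.+-0-commutativeMonoid) using (xy∙z≈xz∙y)

-- ℕtoℚ n = (+ n) / 1 is, by definition, ℚ.fromℚᵘ (ℕtoℚᵘ n).
ℕtoℚᵘ : ℕ → ℚᵘ
ℕtoℚᵘ n = mkℚᵘ (+ n) 0

toℚᵘ-ℕtoℚ : ∀ n → toℚᵘ (ℕtoℚ n) ≃ ℕtoℚᵘ n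
toℚᵘ-ℕtoℚ n = ℚ.toℚᵘ-fromℚᵘ (ℕtoℚᵘ n)

ℕtoℚᵘ-+ : ∀ m n → ℕtoℚᵘ (m + n) ≃ ℕtoℚᵘ m ℚᵘ.+ ℕtoℚᵘ n
ℕtoℚᵘ-+ m n = *≡* (cong (ℤ._* + 1)
  (trans (ℤ.pos-+ m n) (sym (cong₂ ℤ._+_ (ℤ.*-identityʳ (+ m)) (ℤ.*-identityʳ (+ n))))))

ℕtoℚᵘ-* : ∀ m n → ℕtoℚᵘ (m * n) ≃ ℕtoℚᵘ m ℚᵘ.* ℕtoℚᵘ n
ℕtoℚᵘ-* m n = *≡* (cong (ℤ._* + 1) (ℤ.pos-* m n))

ℕtoℚ-+ : ∀ m n → ℕtoℚ (m + n) ≡ ℕtoℚ m ℚ.+ ℕtoℚ n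
ℕtoℚ-+ m n = ℚ.toℚᵘ-injective (begin
  toℚᵘ (ℕtoℚ (m + n))                ≈⟨ toℚᵘ-ℕtoℚ (m + n) ⟩
  ℕtoℚᵘ (m + n)                      ≈⟨ ℕtoℚᵘ-+ m n ⟩
  ℕtoℚᵘ m ℚᵘ.+ ℕtoℚᵘ n               ≈⟨ ℚᵘ.+-cong (toℚᵘ-ℕtoℚ m) (toℚᵘ-ℕtoℚ n) ⟨
  toℚᵘ (ℕtoℚ m) ℚᵘ.+ toℚᵘ (ℕtoℚ n)   ≈⟨ ℚ.toℚᵘ-homo-+ (ℕtoℚ m) (ℕtoℚ n) ⟨
  toℚᵘ (ℕtoℚ m ℚ.+ ℕtoℚ n)           ∎)
  where open ℚᵘ.≃-Reasoning

ℕtoℚ-* : ∀ m n → ℕtoℚ (m * n) ≡ ℕtoℚ m ℚ.* ℕtoℚ n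
ℕtoℚ-* m n = ℚ.toℚᵘ-injective (begin
  toℚᵘ (ℕtoℚ (m * n))                ≈⟨ toℚᵘ-ℕtoℚ (m * n) ⟩
  ℕtoℚᵘ (m * n)                      ≈⟨ ℕtoℚᵘ-* m n ⟩
  ℕtoℚᵘ m ℚᵘ.* ℕtoℚᵘ n               ≈⟨ ℚᵘ.*-cong (toℚᵘ-ℕtoℚ m) (toℚᵘ-ℕtoℚ n) ⟨
  toℚᵘ (ℕtoℚ m) ℚᵘ.* toℚᵘ (ℕtoℚ n)   ≈⟨ ℚ.toℚᵘ-homo-* (ℕtoℚ m) (ℕtoℚ n) ⟨
  toℚᵘ (ℕtoℚ m ℚ.* ℕtoℚ n)           ∎)
  where open ℚᵘ.≃-Reasoning

k*n/n≡k : ∀ k n .{{_ : NonZero n}} → (+ (k * n)) / n ≡ ℕtoℚ k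
k*n/n≡k k n@(suc _) = ℚ.fromℚᵘ-cong {mkℚᵘ (+ (k * n)) _} {ℕtoℚᵘ k}
  (*≡* (trans (ℤ.*-identityʳ _) (ℤ.pos-* k n)))

sqQuot-exact : ∀ {x} k n .{{_ : NonZero n}} → x ≡ k * n → sqQuot x n ≡ ℕtoℚ (k * k)
sqQuot-exact k n refl = trans (cong (λ q → q ℚ.* q) (k*n/n≡k k n)) (sym (ℕtoℚ-* k k))

pythagorean⇒leg≤hypotenuse : ∀ {a u v} → u * u ≡ a * a + v * v → v ≤ u
pythagorean⇒leg≤hypotenuse {a} {u} {v} h = ℕ.≮⇒≥ λ u<v →
  ℕ.<⇒≱ (ℕ.*-mono-< u<v u<v) (subst (v * v ≤_) (sym h) (ℕ.m≤n+m (v * v) (a * a)))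

term-pythagorean : ∀ a u v (v>0 : 0 < v) → u * u ≡ a * a + v * v →
                   term a u v v>0 ≡ ℕtoℚ (2 * (u * u) + 2 * (v * v))
term-pythagorean a u v v>0 h with ℕ.m≤n⇒∃[o]m+o≡n {v} {u} (pythagorean⇒leg≤hypotenuse {a} h)
... | k , refl = begin
  term a (v + k) v v>0             ≡⟨ cong (ℚ._+ ℕtoℚ (D * D)) (sqQuot-exact k D a²≡k*D) ⟩
  ℕtoℚ (k * k) ℚ.+ ℕtoℚ (D * D)    ≡⟨ ℕtoℚ-+ (k * k) (D * D) ⟨
  ℕtoℚ (k * k + D * D)             ≡⟨ cong ℕtoℚ (square-sum v k) ⟩
  ℕtoℚ (2 * ((v + k) * (v + k)) + 2 * (v * v)) ∎
  where
  open ≡-Reasoning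
  D = v + k + v
  instance
    _ : NonZero D
    _ = >-nonZero (sumPos (v + k) v v>0)
  square-split : ∀ v k → (v + k) * (v + k) ≡ k * (v + k + v) + v * v
  square-split = solve-∀
  square-sum : ∀ v k → k * k + (v + k + v) * (v + k + v) ≡ 2 * ((v + k) * (v + k)) + 2 * (v * v)
  square-sum = solve-∀
  a²≡k*D : a * a ≡ k * D
  a²≡k*D = ℕ.+-cancelʳ-≡ (v * v) (a * a) (k * D) (trans (sym h) (square-split v k))

lemma4 : (a b c d e f g : ℕ) →
    (pa : 0 < a) → (pb : 0 < b) → (pc : 0 < c) → (pd : 0 < d) →
    (pe : 0 < e) → (pf : 0 < f) → (pg : 0 < g) →
    d * d ≡ a * a + b * b →
    e * e ≡ a * a + c * c →
    f * f ≡ b * b + c * c →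
    g * g ≡ a * a + b * b + c * c →
    lhs4 a b c d e f g pb pc pf ≡ rhs4 a b c d e f g pb pc pf
lemma4 a b c d e f g _ pb pc _ _ pf _ hd he hf hg = begin
  lhs4 a b c d e f g pb pc pf
    ≡⟨ xy∙z≈xz∙y (sqQuot (a * a) G) (ℕtoℚ (2 * (a * a))) (ℕtoℚ (G * G)) ⟩
  term a g f pf ℚ.+ ℕtoℚ (2 * (a * a))
    ≡⟨ cong (ℚ._+ ℕtoℚ (2 * (a * a))) (term-pythagorean a g f pf g²≡a²+f²) ⟩
  ℕtoℚ (2 * (g * g) + 2 * (f * f)) ℚ.+ ℕtoℚ (2 * (a * a))
    ≡⟨ ℕtoℚ-+ (2 * (g * g) + 2 * (f * f)) (2 * (a * a)) ⟨
  ℕtoℚ (2 * (g * g) + 2 * (f * f) + 2 * (a * a))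
    ≡⟨ cong ℕtoℚ sums-agree ⟩
  ℕtoℚ (2 * (d * d) + 2 * (b * b) + (2 * (e * e) + 2 * (c * c)))
    ≡⟨ ℕtoℚ-+ (2 * (d * d) + 2 * (b * b)) (2 * (e * e) + 2 * (c * c)) ⟩
  ℕtoℚ (2 * (d * d) + 2 * (b * b)) ℚ.+ ℕtoℚ (2 * (e * e) + 2 * (c * c))
    ≡⟨ cong₂ ℚ._+_ (term-pythagorean a d b pb hd) (term-pythagorean a e c pc he) ⟨
  rhs4 a b c d e f g pb pc pf
    ∎
  where
  open ≡-Reasoning
  G = g + f
  instance
    _ : NonZero G
    _ = >-nonZero (sumPos g f pf)
  g²≡a²+f² : g * g ≡ a * a + f * f
  g²≡a²+f² = trans hg (trans (ℕ.+-assoc (a * a) (b * b) (c * c)) (cong (λ x → a * a + x) (sym hf)))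
  sums-agree : 2 * (g * g) + 2 * (f * f) + 2 * (a * a)
             ≡ 2 * (d * d) + 2 * (b * b) + (2 * (e * e) + 2 * (c * c))
  sums-agree rewrite hg | hf | hd | he = solve (a ∷ b ∷ c ∷ [])
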